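{- Let $n \geq 1$ and let $a_1, \ldots, a_n, b_1, \ldots, b_n$ be integers with $a_1, \ldots, a_n \geq 0$ and $b_1, \ldots, b_n \geq 1$. If $w = 1^{b_1} 0^{a_1} 1^{b_2} 0^{a_2} \cdots 1^{b_n} 0^{a_n}$, then $$ s([w]_2) = \sum_{1 \leq j \leq n} (-1)^{a_j + a_{j+1} + \cdots + a_n} b_j .$$
   Context: The infinity series $(s(n))_{n \geq 0}$ is the integer sequence defined by $s(0)=0$, $s(2n) = -s(n)$ for $n \geq 1$, and $s(2n+1) = s(n)+1$ for $n \geq 0$. For a binary string $w$ (possibly with leading zeros), $[w]_2$ denotes the integer it represents in base $2$; $1^b$ denotes the string of $b$ ones and $0^a$ the string of $a$ zeros. -}

module Defs where

open import Data.Nat using (ℕ; zero; suc; _+_; _*_; _/_; _%_)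
open import Data.Integer using (ℤ; +_; -_) renaming (_+_ to _+ℤ_; _*_ to _*ℤ_)
open import Data.Bool using (Bool; true; false)
open import Data.List using (List; []; _∷_; _++_; replicate; foldl; concat; map)
open import Data.Fin using (Fin; toℕ)
open import Data.List using (allFin)

-- infinity series, via a fuel argument (fuel ≥ m suffices; s n = sFuel n n)
-- s(0) = 0, s(2k) = - s(k) (k ≥ 1), s(2k+1) = s(k) + 1
sFuel : ℕ → ℕ → ℤ
sFuel zero    m = + 0
sFuel (suc f) zero = + 0
sFuel (suc f) (suc m) with suc m % 2
... | zero  = - sFuel f (suc m / 2)
... | suc _ = sFuel f (suc m / 2) +ℤ + 1

s : ℕ → ℤ
s n = sFuel n n

bit : Bool → ℕ
bit false = 0
bit true  = 1

[_]₂ : List Bool → ℕ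
[ w ]₂ = foldl (λ acc c → 2 * acc + bit c) 0 w

sgn : ℕ → ℤ
sgn zero    = + 1
sgn (suc k) = - sgn k

-- sum over j ∈ Fin n (indices 0..n-1 stand for 1..n)
Σℤ : (n : ℕ) → (Fin n → ℤ) → ℤ
Σℤ n f = Data.List.foldr _+ℤ_ (+ 0) (map f (allFin n))

Σℕ : (n : ℕ) → (Fin n → ℕ) → ℕ
Σℕ n f = Data.List.foldr _+_ 0 (map f (allFin n))

word : (n : ℕ) → (a b : Fin n → ℕ) → List Bool
word n a b = concat (map (λ j → replicate (b j) true ++ replicate (a j) false) (allFin n))

tailSum : (n : ℕ) → (a : Fin n → ℕ) → Fin n → ℕ
tailSum n a j = Σℕ n (λ k → if′ (toℕ j Data.Nat.≤ᵇ toℕ k) (a k))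
  where
  if′ : Bool → ℕ → ℕ
  if′ true  x = x
  if′ false _ = 0

module Submission where

-- Read w from its most significant bit: starting from s(0) = 0, a digit 1 acts on
-- the value of s by x ↦ x + 1 and a digit 0 by x ↦ −x. Hence the block 1^b 0^a
-- acts by x ↦ (−1)^a (x + b), and composing the blocks of w produces the
-- alternating sum, each b_j picking up the signs of all later runs of zeros.

open import Defs
open import Data.Nat using (ℕ; _≥_)
open import Data.Fin using (Fin)
open import Data.Integer using (ℤ; _*_)
open import Relation.Binary.PropositionalEquality using (_≡_)

open import Data.Nat as ℕ using (zero; suc; _≤_; _<_; s≤s; z≤n)
import Data.Nat.Properties as ℕ
open import Data.Nat.DivMod using (m/n<m; m<n⇒m%n≡m; m<n⇒m/n≡0; [m+kn]%n≡m%n; +-distrib-/; m*n%n≡0; m*n/n≡m)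
open import Data.Integer using (+_; -_; _+_)
import Data.Integer.Properties as ℤ
open import Data.Bool using (Bool; true; false)
open import Data.List using (List; []; _∷_; _++_; replicate; foldl; foldr; concat; map; tabulate; allFin)
open import Data.List.Properties using (map-tabulate; map-cong; foldl-++)
import Data.Fin as Fin
open import Function using (_∘_; id)
open import Relation.Binary.PropositionalEquality using (refl; sym; trans; cong; cong₂; subst; module ≡-Reasoning)

[r+m*d]%d≡r : ∀ {r d} m .{{_ : ℕ.NonZero d}} → r < d → (r ℕ.+ m ℕ.* d) ℕ.% d ≡ r
[r+m*d]%d≡r {r} {d} m r<d = trans ([m+kn]%n≡m%n r m d) (m<n⇒m%n≡m r<d)

[r+m*d]/d≡m : ∀ {r d} m .{{_ : ℕ.NonZero d}} → r < d → (r ℕ.+ m ℕ.* d) ℕ./ d ≡ m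
[r+m*d]/d≡m {r} {d} m r<d = begin
  (r ℕ.+ m ℕ.* d) ℕ./ d         ≡⟨ +-distrib-/ r (m ℕ.* d) r%d+m*d%d<d ⟩
  r ℕ./ d ℕ.+ m ℕ.* d ℕ./ d     ≡⟨ cong₂ ℕ._+_ (m<n⇒m/n≡0 r<d) (m*n/n≡m m d) ⟩
  m                             ∎
  where
  open ≡-Reasoning
  r%d+m*d%d<d : r ℕ.% d ℕ.+ m ℕ.* d ℕ.% d < d
  r%d+m*d%d<d = subst (_< d) (sym (trans (cong₂ ℕ._+_ (m<n⇒m%n≡m r<d) (m*n%n≡0 m d)) (ℕ.+-identityʳ r))) r<d

⌊suc-n/2⌋≤n : ∀ n → suc n ℕ./ 2 ≤ n
⌊suc-n/2⌋≤n n = ℕ.≤-pred (m/n<m (suc n) 2 (s≤s (s≤s z≤n)))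

-- Indexed by the remainder mod 2, matching the clauses of sFuel.
digitStep : ℕ → ℤ → ℤ
digitStep zero    x = - x
digitStep (suc _) x = x + + 1

sFuel-unfold : ∀ f n → sFuel (suc f) (suc n) ≡ digitStep (suc n ℕ.% 2) (sFuel f (suc n ℕ./ 2))
sFuel-unfold f n with suc n ℕ.% 2
... | zero  = refl
... | suc _ = refl

sFuel-irrelevant : ∀ {f g} m → m ≤ f → m ≤ g → sFuel f m ≡ sFuel g m
sFuel-irrelevant {f} {g} zero _ _ = trans (sFuel-zero f) (sym (sFuel-zero g))
  where
  sFuel-zero : ∀ f → sFuel f zero ≡ + 0
  sFuel-zero zero    = refl
  sFuel-zero (suc _) = refl
sFuel-irrelevant {suc f} {suc g} (suc m) (s≤s p) (s≤s q) = begin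
  sFuel (suc f) (suc m)                           ≡⟨ sFuel-unfold f m ⟩
  digitStep (suc m ℕ.% 2) (sFuel f (suc m ℕ./ 2)) ≡⟨ cong (digitStep (suc m ℕ.% 2)) halves ⟩
  digitStep (suc m ℕ.% 2) (sFuel g (suc m ℕ./ 2)) ≡⟨ sFuel-unfold g m ⟨
  sFuel (suc g) (suc m)                           ∎
  where
  open ≡-Reasoning
  halves : sFuel f (suc m ℕ./ 2) ≡ sFuel g (suc m ℕ./ 2)
  halves = sFuel-irrelevant (suc m ℕ./ 2) (ℕ.≤-trans (⌊suc-n/2⌋≤n m) p) (ℕ.≤-trans (⌊suc-n/2⌋≤n m) q)

s-unfold : ∀ n .{{_ : ℕ.NonZero n}} → s n ≡ digitStep (n ℕ.% 2) (s (n ℕ./ 2))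
s-unfold (suc n) = trans (sFuel-unfold n n)
  (cong (digitStep (suc n ℕ.% 2)) (sFuel-irrelevant (suc n ℕ./ 2) (⌊suc-n/2⌋≤n n) ℕ.≤-refl))

s-appendDigit : ∀ m {r} → r < 2 → s (2 ℕ.* m ℕ.+ r) ≡ digitStep r (s m)
s-appendDigit zero    (s≤s z≤n)       = refl
s-appendDigit zero    (s≤s (s≤s z≤n)) = refl
s-appendDigit (suc m) {r} r<2 = begin
  s n                                   ≡⟨ s-unfold n ⟩
  digitStep (n ℕ.% 2) (s (n ℕ./ 2))     ≡⟨ cong₂ (λ d q → digitStep d (s q)) n%2≡r n/2≡1+m ⟩
  digitStep r (s (suc m))               ∎
  where
  open ≡-Reasoning
  n : ℕ
  n = 2 ℕ.* suc m ℕ.+ r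
  n≡r+[1+m]*2 : n ≡ r ℕ.+ suc m ℕ.* 2
  n≡r+[1+m]*2 = trans (ℕ.+-comm (2 ℕ.* suc m) r) (cong (r ℕ.+_) (ℕ.*-comm 2 (suc m)))
  n%2≡r : n ℕ.% 2 ≡ r
  n%2≡r = trans (cong (ℕ._% 2) n≡r+[1+m]*2) ([r+m*d]%d≡r (suc m) r<2)
  n/2≡1+m : n ℕ./ 2 ≡ suc m
  n/2≡1+m = trans (cong (ℕ._/ 2) n≡r+[1+m]*2) ([r+m*d]/d≡m (suc m) r<2)

bit<2 : ∀ c → bit c < 2
bit<2 false = s≤s z≤n
bit<2 true  = s≤s (s≤s z≤n)

readBits : ℤ → List Bool → ℤ
readBits = foldl (λ x c → digitStep (bit c) x)

s-foldl : ∀ m w → s (foldl (λ acc c → 2 ℕ.* acc ℕ.+ bit c) m w) ≡ readBits (s m) w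
s-foldl m []      = refl
s-foldl m (c ∷ w) = trans (s-foldl (2 ℕ.* m ℕ.+ bit c) w) (cong (λ x → readBits x w) (s-appendDigit m (bit<2 c)))

readBits-ones : ∀ x b → readBits x (replicate b true) ≡ x + + b
readBits-ones x zero    = sym (ℤ.+-identityʳ x)
readBits-ones x (suc b) = trans (readBits-ones (x + + 1) b) (ℤ.+-assoc x (+ 1) (+ b))

readBits-zeros : ∀ x a → readBits x (replicate a false) ≡ sgn a * x
readBits-zeros x zero    = sym (ℤ.*-identityˡ x)
readBits-zeros x (suc a) = begin
  readBits (- x) (replicate a false) ≡⟨ readBits-zeros (- x) a ⟩
  sgn a * - x                        ≡⟨ ℤ.neg-distribʳ-* (sgn a) x ⟨
  - (sgn a * x)                      ≡⟨ ℤ.neg-distribˡ-* (sgn a) x ⟩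
  - sgn a * x                        ∎
  where open ≡-Reasoning

readBits-block : ∀ x a b → readBits x (replicate b true ++ replicate a false) ≡ sgn a * (x + + b)
readBits-block x a b = begin
  readBits x (replicate b true ++ replicate a false)            ≡⟨ foldl-++ _ x (replicate b true) (replicate a false) ⟩
  readBits (readBits x (replicate b true)) (replicate a false)  ≡⟨ readBits-zeros _ a ⟩
  sgn a * readBits x (replicate b true)                         ≡⟨ cong (sgn a *_) (readBits-ones x b) ⟩
  sgn a * (x + + b)                                             ∎
  where open ≡-Reasoning

sgn-homo-+ : ∀ m n → sgn (m ℕ.+ n) ≡ sgn m * sgn n
sgn-homo-+ zero    n = sym (ℤ.*-identityˡ (sgn n))
sgn-homo-+ (suc m) n = trans (cong -_ (sgn-homo-+ m n)) (ℤ.neg-distribˡ-* (sgn m) (sgn n))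

map-tabulate-suc : ∀ {A : Set} n (f : Fin (suc n) → A) → map f (tabulate Fin.suc) ≡ map (f ∘ Fin.suc) (allFin n)
map-tabulate-suc n f = trans (map-tabulate Fin.suc f) (sym (map-tabulate id (f ∘ Fin.suc)))

Σℕ-suc : ∀ n (f : Fin (suc n) → ℕ) → Σℕ (suc n) f ≡ f Fin.zero ℕ.+ Σℕ n (f ∘ Fin.suc)
Σℕ-suc n f = cong (λ xs → f Fin.zero ℕ.+ foldr ℕ._+_ 0 xs) (map-tabulate-suc n f)

Σℤ-suc : ∀ n (f : Fin (suc n) → ℤ) → Σℤ (suc n) f ≡ f Fin.zero + Σℤ n (f ∘ Fin.suc)
Σℤ-suc n f = cong (λ xs → f Fin.zero + foldr _+_ (+ 0) xs) (map-tabulate-suc n f)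

Σℤ-cong : ∀ n {f g : Fin n → ℤ} → (∀ j → f j ≡ g j) → Σℤ n f ≡ Σℤ n g
Σℤ-cong n f≗g = cong (foldr _+_ (+ 0)) (map-cong f≗g (allFin n))

-- The shifted sum compares toℕ j <ᵇ suc (toℕ k), which only computes once toℕ j is a constructor.
tailSum-suc : ∀ n a j → tailSum (suc n) a (Fin.suc j) ≡ tailSum n (a ∘ Fin.suc) j
tailSum-suc n a j with Fin.toℕ j
... | zero  = cong (foldr ℕ._+_ 0) (map-tabulate-suc n _)
... | suc _ = cong (foldr ℕ._+_ 0) (map-tabulate-suc n _)

word-suc : ∀ n a b → word (suc n) a b ≡
           (replicate (b Fin.zero) true ++ replicate (a Fin.zero) false) ++ word n (a ∘ Fin.suc) (b ∘ Fin.suc)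
word-suc n a b = cong (λ xs → concat (block Fin.zero ∷ xs)) (map-tabulate-suc n block)
  where
  block : Fin (suc n) → List Bool
  block j = replicate (b j) true ++ replicate (a j) false

alternatingSum : (n : ℕ) → (a b : Fin n → ℕ) → ℤ
alternatingSum n a b = Σℤ n (λ j → sgn (tailSum n a j) * + b j)

alternatingSum-suc : ∀ n a b → alternatingSum (suc n) a b ≡
                     sgn (Σℕ (suc n) a) * + b Fin.zero + alternatingSum n (a ∘ Fin.suc) (b ∘ Fin.suc)
alternatingSum-suc n a b = trans (Σℤ-suc n (λ j → sgn (tailSum (suc n) a j) * + b j))
  (cong (_+_ (sgn (Σℕ (suc n) a) * + b Fin.zero)) (Σℤ-cong n (λ j → cong (λ t → sgn t * + b (Fin.suc j)) (tailSum-suc n a j))))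

readBits-word : ∀ n a b x → readBits x (word n a b) ≡ sgn (Σℕ n a) * x + alternatingSum n a b
readBits-word zero    a b x = sym (trans (ℤ.+-identityʳ _) (ℤ.*-identityˡ x))
readBits-word (suc n) a b x = begin
  readBits x (word (suc n) a b)
    ≡⟨ cong (readBits x) (word-suc n a b) ⟩
  readBits x ((replicate b₀ true ++ replicate a₀ false) ++ word n a′ b′)
    ≡⟨ foldl-++ _ x (replicate b₀ true ++ replicate a₀ false) (word n a′ b′) ⟩
  readBits (readBits x (replicate b₀ true ++ replicate a₀ false)) (word n a′ b′)
    ≡⟨ cong (λ y → readBits y (word n a′ b′)) (readBits-block x a₀ b₀) ⟩
  readBits (sgn a₀ * (x + + b₀)) (word n a′ b′)
    ≡⟨ readBits-word n a′ b′ _ ⟩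
  sgn (Σℕ n a′) * (sgn a₀ * (x + + b₀)) + alternatingSum n a′ b′
    ≡⟨ cong (_+ alternatingSum n a′ b′) (sgn-Σ (x + + b₀)) ⟩
  sgn (Σℕ (suc n) a) * (x + + b₀) + alternatingSum n a′ b′
    ≡⟨ cong (_+ alternatingSum n a′ b′) (ℤ.*-distribˡ-+ (sgn (Σℕ (suc n) a)) x (+ b₀)) ⟩
  sgn (Σℕ (suc n) a) * x + sgn (Σℕ (suc n) a) * + b₀ + alternatingSum n a′ b′
    ≡⟨ ℤ.+-assoc (sgn (Σℕ (suc n) a) * x) _ _ ⟩
  sgn (Σℕ (suc n) a) * x + (sgn (Σℕ (suc n) a) * + b₀ + alternatingSum n a′ b′)
    ≡⟨ cong (_+_ (sgn (Σℕ (suc n) a) * x)) (alternatingSum-suc n a b) ⟨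
  sgn (Σℕ (suc n) a) * x + alternatingSum (suc n) a b
    ∎
  where
  open ≡-Reasoning
  a₀ b₀ : ℕ
  a₀ = a Fin.zero
  b₀ = b Fin.zero
  a′ b′ : Fin n → ℕ
  a′ = a ∘ Fin.suc
  b′ = b ∘ Fin.suc
  sgn-Σ : ∀ y → sgn (Σℕ n a′) * (sgn a₀ * y) ≡ sgn (Σℕ (suc n) a) * y
  sgn-Σ y = begin
    sgn (Σℕ n a′) * (sgn a₀ * y)  ≡⟨ ℤ.*-assoc (sgn (Σℕ n a′)) (sgn a₀) y ⟨
    sgn (Σℕ n a′) * sgn a₀ * y    ≡⟨ cong (_* y) (ℤ.*-comm (sgn (Σℕ n a′)) (sgn a₀)) ⟩
    sgn a₀ * sgn (Σℕ n a′) * y    ≡⟨ cong (_* y) (sgn-homo-+ a₀ (Σℕ n a′)) ⟨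
    sgn (a₀ ℕ.+ Σℕ n a′) * y      ≡⟨ cong (λ m → sgn m * y) (Σℕ-suc n a) ⟨
    sgn (Σℕ (suc n) a) * y        ∎

lemma1 : (n : ℕ) → n ≥ 1 → (a b : Fin n → ℕ) → (∀ j → b j ≥ 1) →
    s [ word n a b ]₂ ≡ Σℤ n (λ j → sgn (tailSum n a j) * Data.Integer.+_ (b j))
lemma1 n _ a b _ = begin
  s [ word n a b ]₂                               ≡⟨ s-foldl 0 (word n a b) ⟩
  readBits (+ 0) (word n a b)                     ≡⟨ readBits-word n a b (+ 0) ⟩
  sgn (Σℕ n a) * + 0 + alternatingSum n a b       ≡⟨ cong (_+ alternatingSum n a b) (ℤ.*-zeroʳ (sgn (Σℕ n a))) ⟩
  + 0 + alternatingSum n a b                      ≡⟨ ℤ.+-identityˡ _ ⟩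
  alternatingSum n a b                            ∎
  where open ≡-Reasoning
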